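{- Every resolution refutation of $\mathrm{TPHP}^k_{k-1}$ has pigeon-width at least $k-1$.
   Context: $[m]=\{1,\dots,m\}$. $\mathrm{TPHP}^k_{k-1}$ is the CNF formula over variables $q_{v,w}$ ($v\in[k]$, $w\in[k-1]$) and $z_{v,w}$ ($v\in[k]$, $w\in[k-3]$) consisting of the clauses $q_{v,1}\lor z_{v,1}$ ($v\in[k]$); $\bar z_{v,w}\lor q_{v,w+1}\lor z_{v,w+1}$ ($v\in[k]$, $w\in[k-4]$); $\bar z_{v,k-3}\lor q_{v,k-2}\lor q_{v,k-1}$ ($v\in[k]$); $\bar q_{v,w}\lor\bar q_{v',w}$ ($v\ne v'\in[k]$, $w\in[k-1]$). The variables $q_{v,w},z_{v,w}$ (for all $w$) mention the pigeon $v$. The pigeon-width of a clause is the number of pigeons mentioned by the variables occurring in it, and the pigeon-width of a resolution refutation is the maximum pigeon-width of its clauses. Resolution: a refutation of a CNF $F$ is a sequence of clauses ending with the empty clause, each being a clause of $F$, or $A\lor B$ obtained from earlier $A\lor x$ and $B\lor\bar x$, or a superset of an earlier clause. -}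

module Defs where

open import Data.Nat using (ℕ; zero; suc; _∸_; _⊔_; _≤_)
open import Data.Fin using (Fin; toℕ)
open import Data.Fin.Properties using (_≟_)
open import Data.List using (List; []; _∷_; length; filter; map; foldr; allFin)
open import Data.List.Membership.Propositional using (_∈_)
open import Data.List.Relation.Unary.Any using (Any)
open import Data.List.Relation.Unary.Any.Properties using ()
import Data.List.Relation.Unary.Any as Any
open import Data.Product using (Σ; ∃; _×_; _,_)
open import Relation.Binary.PropositionalEquality using (_≡_; _≢_)
open import Function.Bundles using (_⇔_)

-- Variables of TPHP^k_{k-1}.  Indices are 0-based Fin's:
--   q v w  (v : Fin k, w : Fin (k ∸ 1))  stands for  q_{v+1, w+1}
--   z v w  (v : Fin k, w : Fin (k ∸ 3))  stands for  z_{v+1, w+1}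

data Var (k : ℕ) : Set where
  q : Fin k → Fin (k ∸ 1) → Var k
  z : Fin k → Fin (k ∸ 3) → Var k

pigeon : ∀ {k} → Var k → Fin k
pigeon (q v _) = v
pigeon (z v _) = v

data Lit (k : ℕ) : Set where
  pos : Var k → Lit k
  neg : Var k → Lit k

var : ∀ {k} → Lit k → Var k
var (pos x) = x
var (neg x) = x

-- clauses are disjunctions of literals, treated as sets of literals
Clause : ℕ → Set
Clause k = List (Lit k)

_≋_ : ∀ {k} → Clause k → Clause k → Set
C ≋ D = ∀ l → (l ∈ C) ⇔ (l ∈ D)

_⊆_ : ∀ {k} → Clause k → Clause k → Set
C ⊆ D = ∀ {l} → l ∈ C → l ∈ D

_∪_ : ∀ {k} → Clause k → Clause k → Clause k
A ∪ B = foldr _∷_ B A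

CNF : ℕ → Set₁
CNF k = Clause k → Set

data TPHP (k : ℕ) : CNF k where
  -- q_{v,1} ∨ z_{v,1}
  init : ∀ v (a : Fin (k ∸ 1)) (b : Fin (k ∸ 3)) →
         toℕ a ≡ 0 → toℕ b ≡ 0 →
         TPHP k (pos (q v a) ∷ pos (z v b) ∷ [])
  -- ¬z_{v,w} ∨ q_{v,w+1} ∨ z_{v,w+1}   (w ∈ [k-4])
  mid  : ∀ v (a : Fin (k ∸ 3)) (b : Fin (k ∸ 1)) (c : Fin (k ∸ 3)) →
         toℕ b ≡ suc (toℕ a) → toℕ c ≡ suc (toℕ a) →
         TPHP k (neg (z v a) ∷ pos (q v b) ∷ pos (z v c) ∷ [])
  -- ¬z_{v,k-3} ∨ q_{v,k-2} ∨ q_{v,k-1}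
  last : ∀ v (a : Fin (k ∸ 3)) (b c : Fin (k ∸ 1)) →
         toℕ a ≡ k ∸ 4 → toℕ b ≡ k ∸ 3 → toℕ c ≡ k ∸ 2 →
         TPHP k (neg (z v a) ∷ pos (q v b) ∷ pos (q v c) ∷ [])
  -- ¬q_{v,w} ∨ ¬q_{v',w}   (v ≠ v')
  hole : ∀ v v' (w : Fin (k ∸ 1)) → v ≢ v' →
         TPHP k (neg (q v w) ∷ neg (q v' w) ∷ [])

-- Resolution.  A sequence of clauses is stored in reverse order
-- (head = last clause), so the tail contains exactly the earlier clauses.

data Justified {k} (F : CNF k) (Γ : List (Clause k)) (C : Clause k) : Set where
  axiom  : F C → Justified F Γ C
  resolve : ∀ (x : Var k) (A B C₁ C₂ : Clause k) →
            C₁ ∈ Γ → C₂ ∈ Γ →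
            C₁ ≋ (pos x ∷ A) → C₂ ≋ (neg x ∷ B) → C ≋ (A ∪ B) →
            Justified F Γ C
  weaken : ∀ (D : Clause k) → D ∈ Γ → D ⊆ C → Justified F Γ C

data Derivation {k} (F : CNF k) : List (Clause k) → Set where
  []  : Derivation F []
  _∷_ : ∀ {Γ C} → Justified F Γ C → Derivation F Γ → Derivation F (C ∷ Γ)

Refutation : ∀ {k} → CNF k → List (Clause k) → Set
Refutation F π = Σ (List _) λ Γ → (π ≡ ([] ∷ Γ)) × Derivation F π

clausePigeonWidth : ∀ {k} → Clause k → ℕ
clausePigeonWidth {k} C =
  length (filter (λ v → Any.any? (λ l → pigeon (var l) ≟ v) C) (allFin k))

pigeonWidth : ∀ {k} → List (Clause k) → ℕ
pigeonWidth π = foldr _⊔_ 0 (map clausePigeonWidth π)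

module Submission where

-- The proof is a soundness argument for a restricted semantics.  A partial
-- assignment sends some pigeons injectively to holes; pigeon v sitting in
-- hole h makes q_{v,w} true iff w = h and z_{v,w} true iff w < h.  Call a
-- clause "sound" when every injective partial assignment that places all
-- pigeons the clause mentions satisfies it.
--   * Every axiom of TPHP is sound (a placed pigeon satisfies its chain of
--     clauses, and the hole clauses express injectivity).
--   * Weakening preserves soundness, and so does resolution provided the
--     resolvent mentions fewer than k-1 pigeons: an assignment covering the
--     resolvent can be restricted to its pigeons and then extended to the
--     pigeon of the resolved variable, because fewer than k-1 holes are
--     occupied.
-- Hence if all clauses of a refutation have pigeon-width < k-1, all are
-- sound, including the empty clause; but the empty assignment covers the
-- empty clause without satisfying it.

open import Defs
open import Data.Nat using (ℕ; _+_; _≤_; _∸_; _<_; suc; s≤s; s≤s⁻¹; _≤?_)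
import Data.Nat.Properties as ℕ
open import Data.List using (List; []; _∷_; length; filter; allFin; lookup; mapMaybe)
open import Data.List.Properties using (length-mapMaybe; ++-is-foldr)
open import Data.List.Membership.Propositional using (_∈_; _∉_)
open import Data.List.Membership.Propositional.Properties
  using (∈-filter⁺; ∈-allFin; ∈-++⁺ˡ; ∈-++⁺ʳ)
import Data.List.Membership.DecPropositional as DecMembership
open import Data.List.Relation.Unary.Any using (Any; here; there)
import Data.List.Relation.Unary.Any as Any
open import Data.List.Relation.Unary.Any.Properties using (lookup-index; map⁺; mapMaybe⁺)
open import Data.List.Relation.Unary.All using (All; []; _∷_)
import Data.List.Relation.Unary.All as All
open import Data.Fin using (Fin; toℕ)
open import Data.Fin.Properties using (toℕ-injective; toℕ<n; ¬∀⟶∃¬; pigeonhole)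
  renaming (_≟_ to _≟F_)
open import Data.Maybe using (Maybe; just; nothing)
open import Data.Maybe.Properties using (just-injective)
import Data.Maybe.Relation.Unary.Any as MaybeAny
open import Data.Product using (Σ; ∃; _×_; _,_; proj₁; proj₂)
open import Data.Empty using (⊥-elim)
open import Relation.Nullary using (¬_; Dec; yes; no)
open import Relation.Binary.PropositionalEquality
  using (_≡_; _≢_; refl; sym; trans; cong; subst)
open import Function.Bundles using (Equivalence)

-- A list of fewer than n elements of Fin n misses some element: otherwise
-- the position of each element in the list would inject Fin n into a
-- shorter index set.
freeElement : ∀ {n} (L : List (Fin n)) → length L < n → ∃ λ h → h ∉ L
freeElement {n} L short =
  ¬∀⟶∃¬ n (_∈ L) (λ h → DecMembership._∈?_ _≟F_ h L) notAll
  where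
  notAll : (∀ h → h ∈ L) → _
  notAll all with pigeonhole short (λ h → Any.index (all h))
  ... | i , j , i<j , sameIndex = ℕ.<-irrefl (cong toℕ i≡j) i<j
    where
    i≡j : i ≡ j
    i≡j = trans (lookup-index (all i))
            (trans (cong (lookup L) sameIndex) (sym (lookup-index (all j))))

∈-∪⁺ˡ : ∀ {k} {l : Lit k} A B → l ∈ A → l ∈ A ∪ B
∈-∪⁺ˡ A B m = subst (_ ∈_) (++-is-foldr A B) (∈-++⁺ˡ m)

∈-∪⁺ʳ : ∀ {k} {l : Lit k} A B → l ∈ B → l ∈ A ∪ B
∈-∪⁺ʳ A B m = subst (_ ∈_) (++-is-foldr A B) (∈-++⁺ʳ A m)

Hole : ℕ → Set
Hole k = Fin (k ∸ 1)

Assignment : ℕ → Set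
Assignment k = Fin k → Maybe (Hole k)

HoldsAt : ∀ {k} → Var k → Hole k → Set
HoldsAt (q v w) h = toℕ w ≡ toℕ h
HoldsAt (z v w) h = toℕ w < toℕ h

-- A variable is true when its pigeon is placed and the variable holds there;
-- in particular every variable of an unplaced pigeon is false.
IsTrue : ∀ {k} → Assignment k → Var k → Set
IsTrue g x = ∃ λ h → g (pigeon x) ≡ just h × HoldsAt x h

LitTrue : ∀ {k} → Assignment k → Lit k → Set
LitTrue g (pos x) = IsTrue g x
LitTrue g (neg x) = ¬ IsTrue g x

Satisfies : ∀ {k} → Assignment k → Clause k → Set
Satisfies g C = ∃ λ l → l ∈ C × LitTrue g l

Injective : ∀ {k} → Assignment k → Set
Injective g = ∀ {v v' h} → g v ≡ just h → g v' ≡ just h → v ≡ v'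

Placed : ∀ {k} → Assignment k → Fin k → Set
Placed g v = ∃ λ h → g v ≡ just h

Covers : ∀ {k} → Assignment k → Clause k → Set
Covers g C = ∀ {l} → l ∈ C → Placed g (pigeon (var l))

Sound : ∀ {k} → Clause k → Set
Sound {k} C = ∀ (g : Assignment k) → Injective g → Covers g C → Satisfies g C

pos-at : ∀ {k} (g : Assignment k) {h} x →
         g (pigeon x) ≡ just h → HoldsAt x h → LitTrue g (pos x)
pos-at g x gx holds = _ , gx , holds

neg-at : ∀ {k} (g : Assignment k) {h} x →
         g (pigeon x) ≡ just h → ¬ HoldsAt x h → LitTrue g (neg x)
neg-at g x gx fails (h' , gx' , holds) =
  fails (subst (HoldsAt x) (just-injective (trans (sym gx') gx)) holds)

litTrue-local : ∀ {k} (g g' : Assignment k) l →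
                g (pigeon (var l)) ≡ g' (pigeon (var l)) → LitTrue g l → LitTrue g' l
litTrue-local g g' (pos x) same (h , gx , holds) = h , trans (sym same) gx , holds
litTrue-local g g' (neg x) same false (h , gx , holds) = false (h , trans same gx , holds)

-- Pigeon v in hole h satisfies its chain clauses: if h = 0 then q_{v,1},
-- otherwise z_{v,1}; from z_{v,w} (i.e. w < h) either h = w+1 gives
-- q_{v,w+1}, or w+1 < h gives z_{v,w+1} (resp. q_{v,k-1}, since the
-- largest hole is k-2).  Hole clauses hold by injectivity.
axiom-sound : ∀ m {C} → TPHP (4 + m) C → Sound C
axiom-sound m (init v a b a≡0 b≡0) g inj cov with cov (here refl)
... | h , gv with ℕ._≟_ 0 (toℕ h)
...   | yes h≡0 = _ , here refl , pos-at g (q v a) gv (trans a≡0 h≡0)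
...   | no h≢0 = _ , there (here refl) ,
          pos-at g (z v b) gv (subst (_< toℕ h) (sym b≡0) (ℕ.n≢0⇒n>0 (λ h≡0 → h≢0 (sym h≡0))))
axiom-sound m (mid v a b c b≡a+1 c≡a+1) g inj cov with cov (here refl)
... | h , gv with toℕ a ℕ.<? toℕ h
...   | no a≮h = _ , here refl , neg-at g (z v a) gv a≮h
...   | yes a<h with ℕ._≟_ (suc (toℕ a)) (toℕ h)
...     | yes a+1≡h = _ , there (here refl) , pos-at g (q v b) gv (trans b≡a+1 a+1≡h)
...     | no a+1≢h = _ , there (there (here refl)) ,
            pos-at g (z v c) gv (subst (_< toℕ h) (sym c≡a+1) (ℕ.≤∧≢⇒< a<h a+1≢h))
axiom-sound m (last v a b c a≡m b≡m+1 c≡m+2) g inj cov with cov (here refl)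
... | h , gv with toℕ a ℕ.<? toℕ h
...   | no a≮h = _ , here refl , neg-at g (z v a) gv a≮h
...   | yes a<h with ℕ._≟_ (suc (toℕ a)) (toℕ h)
...     | yes a+1≡h = _ , there (here refl) ,
            pos-at g (q v b) gv (trans b≡m+1 (trans (cong suc (sym a≡m)) a+1≡h))
...     | no a+1≢h = _ , there (there (here refl)) , pos-at g (q v c) gv c≡h
  where
  c≡h : toℕ c ≡ toℕ h
  c≡h = trans c≡m+2 (ℕ.≤-antisym
          (subst (λ t → suc (suc t) ≤ toℕ h) a≡m (ℕ.≤∧≢⇒< a<h a+1≢h))
          (s≤s⁻¹ (toℕ<n h)))
axiom-sound m (hole v v' w v≢v') g inj cov with cov (here refl)
... | h , gv with ℕ._≟_ (toℕ w) (toℕ h)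
...   | no w≢h = _ , here refl , neg-at g (q v w) gv w≢h
...   | yes w≡h = _ , there (here refl) , v'-elsewhere
  where
  v'-elsewhere : ¬ IsTrue g (q v' w)
  v'-elsewhere (h' , gv' , w≡h') =
    v≢v' (inj gv (subst (λ t → g v' ≡ just t) (toℕ-injective (trans (sym w≡h') w≡h)) gv'))

Mentions : ∀ {k} → Clause k → Fin k → Set
Mentions C v = Any (λ l → pigeon (var l) ≡ v) C

mentions? : ∀ {k} (C : Clause k) (v : Fin k) → Dec (Mentions C v)
mentions? C v = Any.any? (λ l → pigeon (var l) ≟F v) C

mentions-∈ : ∀ {k} {C : Clause k} {l} → l ∈ C → Mentions C (pigeon (var l))
mentions-∈ = Any.map (λ l≡ → cong (λ l → pigeon (var l)) (sym l≡))

pigeonsOf : ∀ {k} → Clause k → List (Fin k)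
pigeonsOf {k} C = filter (mentions? C) (allFin k)

occupiedBy : ∀ {k} → Assignment k → Clause k → List (Hole k)
occupiedBy g C = mapMaybe g (pigeonsOf C)

occupied-∈ : ∀ {k} (g : Assignment k) C {v h} →
             Mentions C v → g v ≡ just h → h ∈ occupiedBy g C
occupied-∈ g C {v} {h} mentioned gv =
  mapMaybe⁺ g (pigeonsOf C)
    (map⁺ (Any.map (λ { refl → subst (MaybeAny.Any (h ≡_)) (sym gv) (MaybeAny.just refl) })
                   (∈-filter⁺ (mentions? C) (∈-allFin v) mentioned)))

restrict : ∀ {k} → Assignment k → Clause k → Assignment k
restrict g C v with mentions? C v
... | yes _ = g v
... | no _ = nothing

restrict-agrees : ∀ {k} (g : Assignment k) {C v} → Mentions C v → restrict g C v ≡ g v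
restrict-agrees g {C} {v} mentioned with mentions? C v
... | yes _ = refl
... | no unmentioned = ⊥-elim (unmentioned mentioned)

restrict-occupied : ∀ {k} (g : Assignment k) C {v h} →
                    restrict g C v ≡ just h → h ∈ occupiedBy g C
restrict-occupied g C {v} rv with mentions? C v
... | yes mentioned = occupied-∈ g C mentioned rv

restrict-injective : ∀ {k} (g : Assignment k) C → Injective g → Injective (restrict g C)
restrict-injective g C inj {v} {v'} rv rv' with mentions? C v | mentions? C v'
... | yes _ | yes _ = inj rv rv'

place : ∀ {k} → Assignment k → Fin k → Hole k → Assignment k
place g p h0 v with v ≟F p
... | yes _ = just h0
... | no _ = g v

place-here : ∀ {k} (g : Assignment k) p h0 → place g p h0 p ≡ just h0
place-here g p h0 with p ≟F p
... | yes _ = refl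
... | no p≢p = ⊥-elim (p≢p refl)

place-elsewhere : ∀ {k} (g : Assignment k) {p} h0 {v} → v ≢ p → place g p h0 v ≡ g v
place-elsewhere g {p} h0 {v} v≢p with v ≟F p
... | yes v≡p = ⊥-elim (v≢p v≡p)
... | no _ = refl

place-injective : ∀ {k} (g : Assignment k) p h0 → Injective g →
                  (∀ {v} → g v ≢ just h0) → Injective (place g p h0)
place-injective g p h0 inj free {v} {v'} gv gv' with v ≟F p | v' ≟F p
... | yes v≡p | yes v'≡p = trans v≡p (sym v'≡p)
... | yes _ | no _ = ⊥-elim (free (subst (λ t → g v' ≡ just t) (just-injective (sym gv)) gv'))
... | no _ | yes _ = ⊥-elim (free (subst (λ t → g v ≡ just t) (just-injective (sym gv')) gv))
... | no _ | no _ = inj gv gv'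

extend : ∀ {k} (g : Assignment k) C p → Injective g → Covers g C →
         clausePigeonWidth C < k ∸ 1 →
         Σ (Assignment k) λ g' → Injective g' × Placed g' p ×
           (∀ {l} → l ∈ C → g' (pigeon (var l)) ≡ g (pigeon (var l)))
extend g C p inj cov narrow with g p in gp
... | just h = g , inj , (h , gp) , λ _ → refl
... | nothing =
  place r p h0 , place-injective r p h0 (restrict-injective g C inj) h0-free ,
  (h0 , place-here r p h0) , agrees
  where
  r = restrict g C
  free = freeElement (occupiedBy g C) (ℕ.≤-<-trans (length-mapMaybe g (pigeonsOf C)) narrow)
  h0 = proj₁ free
  h0-free : ∀ {v} → r v ≢ just h0
  h0-free rv = proj₂ free (restrict-occupied g C rv)
  agrees : ∀ {l} → l ∈ C → place r p h0 (pigeon (var l)) ≡ g (pigeon (var l))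
  agrees {l} l∈C = trans (place-elsewhere r h0 not-p) (restrict-agrees g (mentions-∈ l∈C))
    where
    not-p : pigeon (var l) ≢ p
    not-p refl with cov l∈C
    ... | _ , gl with trans (sym gp) gl
    ...   | ()

-- If g' satisfies both premises and agrees with g on the resolvent, then g
-- satisfies the resolvent: the resolved literals cannot both be true.
resolvent-satisfied :
  ∀ {k} (x : Var k) A B {C C₁ C₂} → C₁ ≋ (pos x ∷ A) → C₂ ≋ (neg x ∷ B) → C ≋ (A ∪ B) →
  (g g' : Assignment k) → (∀ {l} → l ∈ C → g' (pigeon (var l)) ≡ g (pigeon (var l))) →
  Satisfies g' C₁ → Satisfies g' C₂ → Satisfies g C
resolvent-satisfied x A B e₁ e₂ e g g' agree (l , l∈ , t) (l' , l'∈ , t')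
  with Equivalence.to (e₁ l) l∈ | Equivalence.to (e₂ l') l'∈
... | here refl | here refl = ⊥-elim (t' t)
... | there l∈A | _ = l , m , litTrue-local g' g l (agree m) t
  where m = Equivalence.from (e l) (∈-∪⁺ˡ A B l∈A)
... | here refl | there l'∈B = l' , m , litTrue-local g' g l' (agree m) t'
  where m = Equivalence.from (e l') (∈-∪⁺ʳ A B l'∈B)

premise-covered : ∀ {k} {x : Var k} y A {C C₁} → var y ≡ x → C₁ ≋ (y ∷ A) →
  (∀ {l} → l ∈ A → l ∈ C) → (g : Assignment k) →
  Placed g (pigeon x) → Covers g C → Covers g C₁
premise-covered y A vy e sub g px cov {l} m with Equivalence.to (e l) m
... | here refl rewrite vy = px
... | there l∈A = cov (sub l∈A)

resolution-sound :
  ∀ {k} (x : Var k) A B {C C₁ C₂} → clausePigeonWidth C < k ∸ 1 →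
  C₁ ≋ (pos x ∷ A) → C₂ ≋ (neg x ∷ B) → C ≋ (A ∪ B) →
  Sound C₁ → Sound C₂ → Sound C
resolution-sound x A B {C} narrow e₁ e₂ e sound₁ sound₂ g inj cov
  with extend g C (pigeon x) inj cov narrow
... | g' , inj' , px , agree =
  resolvent-satisfied x A B e₁ e₂ e g g' agree
    (sound₁ g' inj' (premise-covered (pos x) A refl e₁ subA g' px cov'))
    (sound₂ g' inj' (premise-covered (neg x) B refl e₂ subB g' px cov'))
  where
  subA : ∀ {l} → l ∈ A → l ∈ C
  subA m = Equivalence.from (e _) (∈-∪⁺ˡ A B m)
  subB : ∀ {l} → l ∈ B → l ∈ C
  subB m = Equivalence.from (e _) (∈-∪⁺ʳ A B m)
  cov' : Covers g' C
  cov' m with cov m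
  ... | h , gl = h , trans (agree m) gl

weakening-sound : ∀ {k} {C D : Clause k} → D ⊆ C → Sound D → Sound C
weakening-sound D⊆C soundD g inj cov with soundD g inj (λ m → cov (D⊆C m))
... | l , l∈D , t = l , D⊆C l∈D , t

derivation-sound : ∀ m {π : List (Clause (4 + m))} → Derivation (TPHP _) π →
  (∀ {C} → C ∈ π → clausePigeonWidth C < 3 + m) → All Sound π
derivation-sound m [] narrow = []
derivation-sound m {C ∷ Γ} (j ∷ d) narrow = justified-sound j ∷ earlier
  where
  earlier = derivation-sound m d (λ C∈Γ → narrow (there C∈Γ))
  justified-sound : Justified (TPHP _) Γ C → Sound C
  justified-sound (axiom ax) = axiom-sound m ax
  justified-sound (resolve x A B C₁ C₂ m₁ m₂ e₁ e₂ e) =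
    resolution-sound x A B (narrow (here refl)) e₁ e₂ e
      (All.lookup earlier m₁) (All.lookup earlier m₂)
  justified-sound (weaken D m D⊆C) = weakening-sound D⊆C (All.lookup earlier m)

-- The empty clause is not sound: the empty assignment covers it.
empty-unsound : ∀ {k} → ¬ Sound {k} []
empty-unsound sound with sound (λ _ → nothing) (λ ()) (λ ())
... | _ , () , _

width-bounds-clause : ∀ {k} (π : List (Clause k)) {C} → C ∈ π →
                      clausePigeonWidth C ≤ pigeonWidth π
width-bounds-clause (C ∷ π) (here refl) = ℕ.m≤m⊔n _ _
width-bounds-clause (D ∷ π) (there m) = ℕ.m≤n⇒m≤o⊔n (clausePigeonWidth D) (width-bounds-clause π m)

lemma3p3 : (k : ℕ) → 4 ≤ k → (π : List (Clause k)) →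
    Refutation (TPHP k) π → k ∸ 1 ≤ pigeonWidth π
lemma3p3 _ (s≤s (s≤s (s≤s (s≤s {n = m} _)))) π (Γ , refl , d)
  with 3 + m ≤? pigeonWidth π
... | yes wide = wide
... | no narrow = ⊥-elim (empty-unsound (All.head allSound))
  where
  allSound = derivation-sound m d
    (λ C∈π → ℕ.≤-<-trans (width-bounds-clause π C∈π) (ℕ.≰⇒> narrow))
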